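{- Let $w=A_1\ldots A_n$ be a step sequence over a comtrace alphabet $\Theta$, and let $\Pi^\perp$ be the projection representation of the comtrace $[w]$. Then \[A_1\subseteq M(\Pi^\perp).\]
   Context: A comtrace alphabet is $\Theta=(\Sigma,\mathit{sim},\mathit{ser})$ with $\mathit{ser}\subseteq\mathit{sim}\subseteq\Sigma\times\Sigma$, $\mathit{sim}$ irreflexive and symmetric. Steps $\mathbb{S}$ are nonempty sets of pairwise $\mathit{sim}$-related actions; comtrace equivalence $\equiv_\Theta$ is the reflexive, symmetric, transitive closure of $uABz\sim u(A\cup B)z$ for $A\times B\subseteq\mathit{ser}$, and $[w]$ denotes the comtrace (equivalence class) of $w$. Derived relations: $\mathit{dep}=(\Sigma\times\Sigma)\setminus\mathit{sim}$, $\mathit{ind}=\mathit{ser}\cap\mathit{ser}^{ -1}$, $\mathit{sin}=\mathit{sim}\setminus\mathit{ser}$, $\mathit{ssm}=\mathit{sim}\setminus(\mathit{ser}\cup\mathit{ser}^{ -1})$, $\mathit{wdp}=\mathit{ser}^{ -1}\setminus\mathit{ser}$. For $(a,b)\notin\mathit{ind}$ (possibly $a=b$), the projection $\Pi^\perp_{a,b}:\mathbb{S}^*\to(\Sigma\cup\{\perp\})^*$ is defined on a step $A$ by: $\epsilon$ if $\{a,b\}\cap A=\emptyset$; $a$ if $a\in A,b\notin A$ (symmetrically $b$ if $b\in A$, $a\notin A$); $ba$ if $\{a,b\}\subseteq A$ and $(a,b)\in\mathit{wdp}$; $ab$ if $\{a,b\}\subseteq A$ and $(b,a)\in\mathit{wdp}$;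 $\perp$ if $\{a,b\}\subseteq A$ and $(a,b)\in\mathit{ssm}$; and extended to step sequences by concatenation. The projection representation of a comtrace $\tau$ is $\Pi^\perp_\tau(a,b)=\Pi^\perp_{a,b}(\tau)$ on $(\Sigma\times\Sigma)\setminus\mathit{ind}$; any function $\Pi^\perp:(\Sigma\times\Sigma)\setminus\mathit{ind}\to(\Sigma\cup\{\perp\})^*$ is a projection set. For a word $x$, write $x[1]$ for its first letter (its 1-prefix) and $x[1..2]$ for its first two letters (its 2-prefix). An action $a$ is conditionally possible for $\Pi^\perp$ iff for all $b\in\Sigma$: $(a,b)\in\mathit{dep}\Rightarrow \Pi^\perp(a,b)[1]=a$; $(b,a)\in\mathit{wdp}\Rightarrow \Pi^\perp(a,b)[1]=a$; $(a,b)\in\mathit{wdp}\Rightarrow \Pi^\perp(a,b)[1]=a$ or $\Pi^\perp(a,b)[1..2]=ba$; $(a,b)\in\mathit{ssm}\Rightarrow \Pi^\perp(a,b)[1]=a$ or $\Pi^\perp(a,b)[1]=\perp$. Let $cpa$ be the set of conditionally possible actions. Define $(a,b)\in cnd$ iff ($(a,b)\in\mathit{wdp}$ and $\Pi^\perp(a,b)[1..2]=ba$) or ($(a,b)\in\mathit{ssm}$ and $\Pi^\perp(a,b)[1]=\perp$). The set $imp$ of impossible actions is the smallest set with $\Sigma\setminus cpa\subseteq imp$ and ($b\in imp\wedge(a,b)\in cnd\Rightarrow a\in imp$). $M(\Pi^\perp)=\Sigma\setminus imp$ is the set of possible actions. -}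

module Defs where

open import Level using (0ℓ)
open import Data.Nat using (ℕ)
open import Data.Fin using (Fin)
open import Data.Fin.Properties using (_≟_)
open import Data.Fin.Subset using (Subset; _∈_; _∉_; Nonempty)
open import Data.Fin.Subset.Properties using (_∈?_)
open import Data.List using (List; []; _∷_; _++_; take; concatMap)
open import Data.Maybe using (Maybe; just; nothing)
open import Data.Product using (_×_; _,_)
open import Data.Sum using (_⊎_)
open import Relation.Nullary using (¬_; yes; no)
open import Relation.Binary using (Rel; Decidable; Irreflexive; Symmetric)
open import Relation.Binary.PropositionalEquality using (_≡_; _≢_)

record ComtraceAlphabet : Set₁ where
  field
    n       : ℕ
    sim     : Rel (Fin n) 0ℓ
    ser     : Rel (Fin n) 0ℓ
    sim?    : Decidable sim
    ser?    : Decidable ser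
    ser⊆sim : ∀ {a b} → ser a b → sim a b
    sim-irr : Irreflexive _≡_ sim
    sim-sym : Symmetric sim

module _ (Θ : ComtraceAlphabet) where
  open ComtraceAlphabet Θ

  Act : Set
  Act = Fin n

  dep : Rel Act 0ℓ
  dep a b = ¬ sim a b

  ind : Rel Act 0ℓ
  ind a b = ser a b × ser b a

  sin : Rel Act 0ℓ
  sin a b = sim a b × ¬ ser a b

  ssm : Rel Act 0ℓ
  ssm a b = sim a b × ¬ ser a b × ¬ ser b a

  wdp : Rel Act 0ℓ
  wdp a b = ser b a × ¬ ser a b

  record Step : Set where
    field
      set      : Subset n
      nonempty : Nonempty set
      pairwise : ∀ {a b} → a ∈ set → b ∈ set → a ≢ b → sim a b
  open Step public

  StepSeq : Set
  StepSeq = List Step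

  data Sym : Set where
    act : Act → Sym
    bot : Sym

  projStep : Act → Act → Step → List Sym
  projStep a b A with a ∈? set A | b ∈? set A
  ... | no _  | no _  = []
  ... | yes _ | no _  = act a ∷ []
  ... | no _  | yes _ = act b ∷ []
  ... | yes _ | yes _ with a ≟ b
  ...   | yes _ = act a ∷ []
  ...   | no _ with ser? a b | ser? b a
  ...     | no _  | yes _ = act b ∷ act a ∷ []
  ...     | yes _ | no _  = act a ∷ act b ∷ []
  ...     | yes _ | yes _ = []                      -- (a,b) ∈ ind: never used
  ...     | no _  | no _ with sim? a b
  ...       | yes _ = bot ∷ []
  ...       | no _  = []                             -- impossible inside a step

  proj : Act → Act → StepSeq → List Sym
  proj a b w = concatMap (projStep a b) w

  -- projection sets (only values on pairs outside ind are ever consulted)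
  ProjSet : Set
  ProjSet = Act → Act → List Sym

  projRep : StepSeq → ProjSet
  projRep w a b = proj a b w

  first : List Sym → Maybe Sym
  first []      = nothing
  first (x ∷ _) = just x

  module _ (Π : ProjSet) where
    CPA : Act → Set
    CPA a = ∀ b →
        (dep a b → first (Π a b) ≡ just (act a))
      × (wdp b a → first (Π a b) ≡ just (act a))
      × (wdp a b → first (Π a b) ≡ just (act a) ⊎ take 2 (Π a b) ≡ act b ∷ act a ∷ [])
      × (ssm a b → first (Π a b) ≡ just (act a) ⊎ first (Π a b) ≡ just bot)

    Cnd : Act → Act → Set
    Cnd a b = (wdp a b × take 2 (Π a b) ≡ act b ∷ act a ∷ [])
            ⊎ (ssm a b × first (Π a b) ≡ just bot)

    data Imp : Act → Set where
      base : ∀ {a} → ¬ CPA a → Imp a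
      back : ∀ {a b} → Imp b → Cnd a b → Imp a


    Possible : Act → Set
    Possible a = ¬ Imp a

-- Imp is the least set containing the non-conditionally-possible actions and
-- closed backwards along cnd, so any cnd-closed set of conditionally possible
-- actions is disjoint from it. The actions of the first step form such a set:
-- for a ∈ A₁ the projection Π(a,b) begins with the projection of A₁, which is
-- a, ba (when (a,b) ∈ wdp), ⊥ (when (a,b) ∈ ssm), or empty (when (a,b) ∈ ind,
-- making every condition vacuous); and (a,b) ∈ cnd forces b into A₁, since for
-- b ∉ A₁ the projection starts with a.
module Submission where

open import Defs
open import Data.List using (List; []; _∷_; _++_; take)
open import Data.Fin.Subset using (_∈_; _∉_)
open import Data.Fin.Subset.Properties using (_∈?_)
open import Data.Fin.Properties using (_≟_)
open import Data.Maybe using (just)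
open import Data.Product using (_×_; _,_)
open import Data.Sum using (_⊎_; inj₁; inj₂)
open import Relation.Nullary using (¬_; yes; no; contradiction)
open import Relation.Nullary.Decidable using (decidable-stable)
open import Relation.Binary.PropositionalEquality using (_≡_; refl)

module _ (Θ : ComtraceAlphabet) where
  open ComtraceAlphabet Θ

  closed⇒possible : (Π : ProjSet Θ) (P : Act Θ → Set) →
    (∀ {a} → P a → CPA Θ Π a) →
    (∀ {a b} → P a → Cnd Θ Π a b → P b) →
    ∀ {a} → P a → Possible Θ Π a
  closed⇒possible Π P cpa closed p (base ¬cpa)  = ¬cpa (cpa p)
  closed⇒possible Π P cpa closed p (back imp c) =
    closed⇒possible Π P cpa closed (closed p c) imp

  cnd⇒¬leading : ∀ (Π : ProjSet Θ) {a b} → Cnd Θ Π a b → ¬ first Θ (Π a b) ≡ just (act a)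
  cnd⇒¬leading Π {a} {b} (inj₁ ((ba , ¬ab) , take₂≡ba)) = wdp-leading (Π a b) take₂≡ba
    where
      wdp-leading : ∀ l → take 2 l ≡ act b ∷ act a ∷ [] → ¬ first Θ l ≡ just (act a)
      wdp-leading (_ ∷ _ ∷ _) refl refl = ¬ab ba
  cnd⇒¬leading Π {a} {b} (inj₂ (_ , first≡⊥)) = ⊥-leading (Π a b) first≡⊥
    where
      ⊥-leading : ∀ l → first Θ l ≡ just bot → ¬ first Θ l ≡ just (act a)
      ⊥-leading (_ ∷ _) refl ()

  -- CPA Θ Π a unfolds definitionally to ∀ b → CPAAt a b (Π a b).
  CPAAt : Act Θ → Act Θ → List (Sym Θ) → Set
  CPAAt a b l =
        (dep Θ a b → first Θ l ≡ just (act a))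
      × (wdp Θ b a → first Θ l ≡ just (act a))
      × (wdp Θ a b → first Θ l ≡ just (act a) ⊎ take 2 l ≡ act b ∷ act a ∷ [])
      × (ssm Θ a b → first Θ l ≡ just (act a) ⊎ first Θ l ≡ just bot)

  leading⇒CPAAt : ∀ a b rest → CPAAt a b (act a ∷ rest)
  leading⇒CPAAt a b rest = (λ _ → refl) , (λ _ → refl) , (λ _ → inj₁ refl) , (λ _ → inj₁ refl)

  data StepView (a b : Act Θ) : List (Sym Θ) → Set where
    leading : ∀ rest → StepView a b (act a ∷ rest)
    wdp-ba  : wdp Θ a b → StepView a b (act b ∷ act a ∷ [])
    ssm-⊥   : ssm Θ a b → StepView a b (bot ∷ [])
    ind-ε   : ind Θ a b → StepView a b []

  stepView : ∀ a b (A : Step Θ) → a ∈ set A → StepView a b (projStep Θ a b A)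
  stepView a b A a∈A with a ∈? set A | b ∈? set A
  ... | no a∉A | _     = contradiction a∈A a∉A
  ... | yes _  | no _  = leading []
  ... | yes p  | yes q with a ≟ b
  ...   | yes _ = leading []
  ...   | no a≢b with ser? a b | ser? b a
  ...     | no ¬ab | yes ba = wdp-ba (ba , ¬ab)
  ...     | yes _  | no _   = leading (act b ∷ [])
  ...     | yes ab | yes ba = ind-ε (ab , ba)
  ...     | no ¬ab | no ¬ba with sim? a b
  ...       | yes s  = ssm-⊥ (s , ¬ab , ¬ba)
  ...       | no ¬s  = contradiction (pairwise A p q a≢b) ¬s

  stepView⇒CPAAt : ∀ {a b l} → StepView a b l → ∀ rest → CPAAt a b (l ++ rest)
  stepView⇒CPAAt (leading l) rest = leading⇒CPAAt _ _ (l ++ rest)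
  stepView⇒CPAAt (wdp-ba (ba , ¬ab)) _ =
      (λ ¬sim → contradiction (sim-sym (ser⊆sim ba)) ¬sim)
    , (λ (ab , _) → contradiction ab ¬ab)
    , (λ _ → inj₂ refl)
    , (λ (_ , _ , ¬ba) → contradiction ba ¬ba)
  stepView⇒CPAAt (ssm-⊥ (s , ¬ab , ¬ba)) _ =
      (λ ¬sim → contradiction s ¬sim)
    , (λ (ab , _) → contradiction ab ¬ab)
    , (λ (ba , _) → contradiction ba ¬ba)
    , (λ _ → inj₂ refl)
  stepView⇒CPAAt (ind-ε (ab , ba)) _ =
      (λ ¬sim → contradiction (ser⊆sim ab) ¬sim)
    , (λ (_ , ¬ba) → contradiction ba ¬ba)
    , (λ (_ , ¬ab) → contradiction ab ¬ab)
    , (λ (_ , ¬ab , _) → contradiction ab ¬ab)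

  projStep-outside : ∀ {a b} (A : Step Θ) → a ∈ set A → b ∉ set A →
    projStep Θ a b A ≡ act a ∷ []
  projStep-outside {a} {b} A a∈A b∉A with a ∈? set A | b ∈? set A
  ... | no a∉A | _     = contradiction a∈A a∉A
  ... | yes _  | yes q = contradiction q b∉A
  ... | yes _  | no _  = refl

  module _ (A₁ : Step Θ) (As : StepSeq Θ) where

    firstStep-CPA : ∀ {a} → a ∈ set A₁ → CPA Θ (projRep Θ (A₁ ∷ As)) a
    firstStep-CPA {a} a∈A₁ b = stepView⇒CPAAt (stepView a b A₁ a∈A₁) (proj Θ a b As)

    firstStep-cndClosed : ∀ {a b} → a ∈ set A₁ → Cnd Θ (projRep Θ (A₁ ∷ As)) a b → b ∈ set A₁
    firstStep-cndClosed {a} {b} a∈A₁ c =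
      decidable-stable (b ∈? set A₁) λ b∉A₁ →
        cnd⇒¬leading (projRep Θ (A₁ ∷ As)) c (leads b∉A₁)
      where
        leads : b ∉ set A₁ → first Θ (projStep Θ a b A₁ ++ proj Θ a b As) ≡ just (act a)
        leads b∉A₁ rewrite projStep-outside A₁ a∈A₁ b∉A₁ = refl

theorem4p5 : (Θ : ComtraceAlphabet) (A₁ : Step Θ) (As : StepSeq Θ) →
    ∀ a → a ∈ set A₁ → Possible Θ (projRep Θ (A₁ ∷ As)) a
theorem4p5 Θ A₁ As a =
  closed⇒possible Θ (projRep Θ (A₁ ∷ As)) (_∈ set A₁)
    (firstStep-CPA Θ A₁ As) (firstStep-cndClosed Θ A₁ As)
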